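{- Fix $k\ge2$. Let $p$ be a full rook placement on a Ferrers board $\lambda$ containing $k\cdots 21$, whose A-sequence $a_k\cdots a_1$ and B-sequence do not coincide. Then $\psi(p)$ contains the pattern $k\cdots 21$, and the A-sequence of $\psi(p)$ begins with $a_k$.
   Context: A Ferrers board $\lambda$ is a finite set of cells $(i,j)$ ($i$ = column, $j$ = row) closed under decreasing either coordinate. A full rook placement on $\lambda$ is a set of cells (dots) with one dot per row and per column; its permutation $\pi$ has $\pi(i)=j$ iff $(i,j)$ is a dot. Dots are identified with their values (rows). An occurrence of $k\cdots21$ in $p$ is a set of dots at positions $i_1<\cdots<i_k$ with $\pi_{i_1}>\cdots>\pi_{i_k}$ and $(i_k,\pi_{i_1})\in\lambda$. The A-sequence $a_k\cdots a_1$ is the occurrence with lexicographically smallest value sequence. The B-sequence $b_k\cdots b_1$: $b_1$ is the leftmost dot ending an occurrence, and for $j\ge2$, $b_j$ is the leftmost dot such that $b_j\cdots b_1$ ends an occurrence. The B-shift $\psi(p)$ places the values $b_{k-1},b_{k-2},\ldots,b_1,b_k$ at the positions previously occupied by $b_k,b_{k-1},\ldots,b_2,b_1$ respectively, other dots unchanged. -}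

module Defs where

open import Data.Nat as ℕ using (ℕ; zero; suc)
open import Data.Fin using (Fin; zero; suc; fromℕ; inject₁; _<_; _≤_; _≟_)
open import Data.Fin.Permutation using (Permutation′; _⟨$⟩ʳ_)
open import Data.Bool using (Bool; T; if_then_else_)
open import Data.Product using (Σ; ∃; _×_)
open import Data.Unit using (⊤)
open import Relation.Nullary using (¬_; does)
open import Relation.Binary.PropositionalEquality using (_≡_)
open import Function using (_∘_)

-- Conventions: columns and rows are indexed by Fin n (0-based).
-- A board is a Bool-valued predicate on cells (column, row).
Board : ℕ → Set
Board n = Fin n → Fin n → Bool

IsFerrers : ∀ {n} → Board n → Set
IsFerrers {n} L = ∀ (i i' j j' : Fin n) → T (L i j) → i' ≤ i → j' ≤ j → T (L i' j')

IsFullRook : ∀ {n} → Board n → Permutation′ n → Set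
IsFullRook {n} L π = ∀ (i : Fin n) → T (L i (π ⟨$⟩ʳ i))

-- A candidate k-sequence of dots is given by its positions (columns), listed in
-- reading order: index 0 is the leftmost dot (d_k), index k-1 the rightmost (d_1).
-- σ gives the value (row) of the dot in each column.
Occ : ∀ {n} k → Board n → (Fin n → Fin n) → (Fin k → Fin n) → Set
Occ zero    L σ c = ⊤
Occ (suc m) L σ c =
  (∀ s t → s < t → c s < c t) ×
  (∀ s t → s < t → σ (c t) < σ (c s)) ×
  T (L (c (fromℕ m)) (σ (c zero)))

Contains : ∀ {n} k → Board n → (Fin n → Fin n) → Set
Contains k L σ = ∃ λ c → Occ k L σ c

LexLT : ∀ {n k} → (Fin k → Fin n) → (Fin k → Fin n) → Set
LexLT {n} {k} u v = ∃ λ (t : Fin k) → u t < v t × (∀ s → s < t → u s ≡ v s)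

IsASeq : ∀ {n} k → Board n → (Fin n → Fin n) → (Fin k → Fin n) → Set
IsASeq k L σ a = Occ k L σ a × (∀ c → Occ k L σ c → ¬ LexLT (σ ∘ c) (σ ∘ a))

-- B-sequence: for index t (t = k-j, i.e. dot b_j), b t is the leftmost position x such
-- that some occurrence c has c t = x and agrees with b at all later indices.
IsBSeq : ∀ {n} k → Board n → (Fin n → Fin n) → (Fin k → Fin n) → Set
IsBSeq k L σ b = ∀ t →
  (∃ λ c → Occ k L σ c × c t ≡ b t × (∀ s → t < s → c s ≡ b s)) ×
  (∀ c → Occ k L σ c → (∀ s → t < s → c s ≡ b s) → b t ≤ c t)

assign : ∀ {n} m → (Fin m → Fin n) → (Fin m → Fin n) → Fin n → Fin n → Fin n
assign zero    pos vals c d = d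
assign (suc m) pos vals c d =
  if does (c ≟ pos zero) then vals zero else assign m (pos ∘ suc) (vals ∘ suc) c d

-- B-shift: the dot at position b t (t < k-1) receives the value of b (t+1);
-- the position of b_1 (index k-1) receives the value of b_k (index 0);
-- all other columns unchanged.
ψ : ∀ {n} k → (Fin n → Fin n) → (Fin k → Fin n) → Fin n → Fin n
ψ zero    σ b = σ
ψ (suc m) σ b c =
  if does (c ≟ b (fromℕ m)) then σ (b zero)
  else assign m (b ∘ inject₁) (σ ∘ b ∘ suc) c (σ c)

-- Write σ for π, τ = ψ σ, and index the A- and B-sequences α, β from the left, so α 0 = a_k.
-- Since ψ hands the value of β (j + 1) to the position of β j, moving every dot of α that equals
-- some β (j + 1) to β j gives a τ-occurrence with the values of α, hence starting with σ (α 0).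
-- That the moved sequence still increases rests on two exchange properties (α i = β j forces i ≤ j,
-- and the dot of α before a common dot is not right of the corresponding dot of β); the move needs
-- α 0 ≠ β 0, which holds because A- and B-sequences sharing their first dot coincide. All three
-- come from splicing α and β into an occurrence that contradicts the minimality of one of them.
-- Conversely a τ-occurrence starting below σ (β 0) pulls back to a σ-occurrence with the same first
-- value, so by lexicographic minimality of α no τ-occurrence starts below σ (α 0).

module Submission where

open import Defs
open import Data.Nat using (ℕ; s≤s; z≤n)
open import Data.Nat.Properties using (≤-trans)
open import Data.Fin using (Fin; fromℕ<)
open import Data.Fin.Permutation using (Permutation′; _⟨$⟩ʳ_)
open import Data.Product using (∃; _×_)
open import Relation.Nullary using (¬_)
open import Relation.Binary.PropositionalEquality using (_≡_)

open import Data.Nat as ℕ using (zero; suc; _+_; _*_; _^_; _∸_)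
import Data.Nat.Properties as ℕₚ
open import Data.Nat.DivMod using (_mod_; m<n⇒m%n≡m)
open import Data.Nat.Induction using (<-wellFounded)
open import Data.Fin as F using (toℕ; fromℕ; inject₁; _≟_)
import Data.Fin.Properties as Fₚ
open import Data.Fin.Permutation using (_⟨$⟩ˡ_; inverseˡ)
open import Data.Vec.Functional using (_∷_)
open import Data.Bool using (T)
open import Data.Product using (_,_; proj₁; proj₂)
open import Data.Sum using (_⊎_; inj₁; inj₂)
open import Data.Unit using (tt)
open import Data.Empty using (⊥; ⊥-elim)
open import Relation.Nullary using (Dec; yes; no; contradiction)
open import Relation.Nullary.Decidable using (_×-dec_; _→-dec_; T?)
open import Relation.Binary.Definitions using (tri<; tri≈; tri>)
open import Relation.Binary.PropositionalEquality
  using (_≢_; refl; sym; trans; cong; subst; subst₂; module ≡-Reasoning)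
open import Induction.WellFounded using (WellFounded; Acc; acc; module Subrelation)
import Relation.Binary.Construct.On as On
open import Function using (_∘_)

-- Existence of A-sequences

Occ-cong : ∀ {n} k (L : Board n) (ρ : Fin n → Fin n) {c d : Fin k → Fin n} →
           (∀ i → c i ≡ d i) → Occ k L ρ c → Occ k L ρ d
Occ-cong zero    _ _ _   _ = tt
Occ-cong (suc m) L ρ c≗d (increasing , decreasing , corner) =
  (λ s t s<t → subst₂ F._<_ (c≗d s) (c≗d t) (increasing s t s<t)) ,
  (λ s t s<t → subst₂ F._<_ (cong ρ (c≗d t)) (cong ρ (c≗d s)) (decreasing s t s<t)) ,
  subst₂ (λ x y → T (L x y)) (c≗d (fromℕ m)) (cong ρ (c≗d F.zero)) corner

Occ? : ∀ {n} k (L : Board n) (ρ : Fin n → Fin n) (c : Fin k → Fin n) → Dec (Occ k L ρ c)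
Occ? zero    L ρ c = yes tt
Occ? (suc m) L ρ c =
  Fₚ.all? (λ s → Fₚ.all? λ t → (s F.<? t) →-dec (c s F.<? c t)) ×-dec
  (Fₚ.all? (λ s → Fₚ.all? λ t → (s F.<? t) →-dec (ρ (c t) F.<? ρ (c s))) ×-dec
   T? (L (c (fromℕ m)) (ρ (c F.zero))))

LexLT? : ∀ {n k} (u v : Fin k → Fin n) → Dec (LexLT u v)
LexLT? u v = Fₚ.any? λ t → (u t F.<? v t) ×-dec Fₚ.all? (λ s → (s F.<? t) →-dec (u s ≟ v s))

LexLT-congˡ : ∀ {n k} {u u′ v : Fin k → Fin n} → (∀ i → u i ≡ u′ i) → LexLT u v → LexLT u′ v
LexLT-congˡ u≗u′ (t , u<v , u≡v) =
  t , subst (F._< _) (u≗u′ t) u<v , λ s s<t → trans (sym (u≗u′ s)) (u≡v s s<t)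

∃-sequence? : ∀ {n} k (P : (Fin k → Fin n) → Set) →
              (∀ {c d} → (∀ i → c i ≡ d i) → P c → P d) → (∀ c → Dec (P c)) → Dec (∃ P)
∃-sequence? zero P resp P? with P? (λ ())
... | yes p = yes (_ , p)
... | no ¬p = no λ (c , p) → ¬p (resp (λ ()) p)
∃-sequence? (suc k) P resp P?
  with Fₚ.any? (λ x → ∃-sequence? k (P ∘ (x ∷_)) (λ c≗d → resp λ { F.zero → refl ; (F.suc i) → c≗d i })
                                      (P? ∘ (x ∷_)))
... | yes (x , c , p) = yes (x ∷ c , p)
... | no ¬p = no λ (c , p) → ¬p (c F.zero , c ∘ F.suc , resp (λ { F.zero → refl ; (F.suc i) → refl }) p)

encode : ∀ {n k} → (Fin k → Fin n) → ℕ
encode {k = zero}    u = 0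
encode {n} {suc k} u = toℕ (u F.zero) * n ^ k + encode (u ∘ F.suc)

digit-< : ∀ x {y N} → y ℕ.< N → x * N + y ℕ.< suc x * N
digit-< x {y} {N} y<N = begin-strict
  x * N + y  <⟨ ℕₚ.+-monoʳ-< (x * N) y<N ⟩
  x * N + N  ≡⟨ ℕₚ.+-comm (x * N) N ⟩
  suc x * N  ∎
  where open ℕₚ.≤-Reasoning

encode-bound : ∀ {n} k (u : Fin k → Fin n) → encode u ℕ.< n ^ k
encode-bound zero    u = s≤s z≤n
encode-bound {n} (suc k) u =
  ℕₚ.<-≤-trans (digit-< (toℕ (u F.zero)) (encode-bound k (u ∘ F.suc)))
               (ℕₚ.*-monoˡ-≤ (n ^ k) (Fₚ.toℕ<n (u F.zero)))

encode-lex : ∀ {n} k {u v : Fin k → Fin n} → LexLT u v → encode u ℕ.< encode v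
encode-lex {n} (suc k) {u} {v} (F.zero , u₀<v₀ , _) = begin-strict
  encode u                     <⟨ digit-< (toℕ (u F.zero)) (encode-bound k (u ∘ F.suc)) ⟩
  suc (toℕ (u F.zero)) * n ^ k  ≤⟨ ℕₚ.*-monoˡ-≤ (n ^ k) u₀<v₀ ⟩
  toℕ (v F.zero) * n ^ k        ≤⟨ ℕₚ.m≤m+n _ _ ⟩
  encode v                     ∎
  where open ℕₚ.≤-Reasoning
encode-lex {n} (suc k) {u} {v} (F.suc t , u<v , u≡v) = begin-strict
  toℕ (u F.zero) * n ^ k + encode (u ∘ F.suc)  ≡⟨ cong (λ x → toℕ x * n ^ k + _) (u≡v F.zero (s≤s z≤n)) ⟩
  toℕ (v F.zero) * n ^ k + encode (u ∘ F.suc)  <⟨ ℕₚ.+-monoʳ-< _ tail< ⟩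
  encode v                                     ∎
  where
  open ℕₚ.≤-Reasoning
  tail< : encode (u ∘ F.suc) ℕ.< encode (v ∘ F.suc)
  tail< = encode-lex k (t , u<v , λ s s<t → u≡v (F.suc s) (s≤s s<t))

LexLT-wellFounded : ∀ {n k} → WellFounded (LexLT {n} {k})
LexLT-wellFounded {k = k} = Subrelation.wellFounded (encode-lex k) (On.wellFounded encode <-wellFounded)

A-sequence-exists : ∀ {n} k (L : Board n) (ρ : Fin n → Fin n) → Contains k L ρ → ∃ (IsASeq k L ρ)
A-sequence-exists {n} k L ρ (c , occ) = descend c occ (LexLT-wellFounded (ρ ∘ c))
  where
  Below : (Fin k → Fin n) → (Fin k → Fin n) → Set
  Below c d = Occ k L ρ d × LexLT (ρ ∘ d) (ρ ∘ c)

  below? : ∀ c → Dec (∃ (Below c))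
  below? c = ∃-sequence? k (Below c)
    (λ d≗d′ (occ , d<c) → Occ-cong k L ρ d≗d′ occ , LexLT-congˡ (cong ρ ∘ d≗d′) d<c)
    (λ d → Occ? k L ρ d ×-dec LexLT? (ρ ∘ d) (ρ ∘ c))

  descend : ∀ c → Occ k L ρ c → Acc LexLT (ρ ∘ c) → ∃ (IsASeq k L ρ)
  descend c occ (acc smaller) with below? c
  ... | yes (d , occ′ , d<c) = descend d occ′ (smaller d<c)
  ... | no ¬below = c , occ , λ d occ′ d<c → ¬below (d , occ′ , d<c)

-- Evaluating the B-shift

assign-hit : ∀ {n} m (pos vals : Fin m → Fin n) d → (∀ {i j} → pos i ≡ pos j → i ≡ j) →
             ∀ i → assign m pos vals (pos i) d ≡ vals i
assign-hit (suc m) pos vals d pos-injective i with pos i ≟ pos F.zero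
... | yes pᵢ≡p₀ = cong vals (sym (pos-injective pᵢ≡p₀))
... | no pᵢ≢p₀ with i
...   | F.zero  = contradiction refl pᵢ≢p₀
...   | F.suc i = assign-hit m (pos ∘ F.suc) (vals ∘ F.suc) d (Fₚ.suc-injective ∘ pos-injective) i

assign-miss : ∀ {n} m (pos vals : Fin m → Fin n) c d → (∀ i → c ≢ pos i) → assign m pos vals c d ≡ d
assign-miss zero    pos vals c d c∉pos = refl
assign-miss (suc m) pos vals c d c∉pos with c ≟ pos F.zero
... | yes c≡p₀ = contradiction c≡p₀ (c∉pos F.zero)
... | no _     = assign-miss m (pos ∘ F.suc) (vals ∘ F.suc) c d (c∉pos ∘ F.suc)

module _ {n m} (σ : Fin n → Fin n) (b : Fin (suc m) → Fin n) where

  ψ-last : ψ (suc m) σ b (b (fromℕ m)) ≡ σ (b F.zero)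
  ψ-last with b (fromℕ m) ≟ b (fromℕ m)
  ... | yes _ = refl
  ... | no b≢b = contradiction refl b≢b

  ψ-inner : (∀ {i j} → b i ≡ b j → i ≡ j) → ∀ i → ψ (suc m) σ b (b (inject₁ i)) ≡ σ (b (F.suc i))
  ψ-inner b-injective i with b (inject₁ i) ≟ b (fromℕ m)
  ... | yes bᵢ≡bₘ = contradiction (sym (b-injective bᵢ≡bₘ)) Fₚ.fromℕ≢inject₁
  ... | no _      = assign-hit m (b ∘ inject₁) (σ ∘ b ∘ F.suc) _ (Fₚ.inject₁-injective ∘ b-injective) i

  ψ-outside : ∀ c → (∀ i → c ≢ b i) → ψ (suc m) σ b c ≡ σ c
  ψ-outside c c∉b with c ≟ b (fromℕ m)
  ... | yes c≡bₘ = contradiction c≡bₘ (c∉b _)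
  ... | no _     = assign-miss m (b ∘ inject₁) (σ ∘ b ∘ F.suc) c (σ c) (c∉b ∘ inject₁)

-- Decreasing chains

-- Sequences are indexed by ℕ so that splicing and shifting need no Fin arithmetic; only the
-- indices below k are meaningful, and `idx` (reduction mod k) reads a Fin-indexed sequence off.
Seq : ℕ → Set
Seq n = ℕ → Fin n

Inversion : ∀ {n} → (Fin n → Fin n) → Fin n → Fin n → Set
Inversion ρ x y = x F.< y × ρ y F.< ρ x

record Chain {n} (ρ : Fin n → Fin n) (f : Seq n) (lo hi : ℕ) : Set where
  constructor chain
  field link : ∀ r → lo ℕ.≤ r → suc r ℕ.< hi → Inversion ρ (f r) (f (suc r))

open Chain

module _ {n : ℕ} where

  splice : ℕ → Seq n → Seq n → Seq n
  splice p f g r with r ℕ.<? p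
  ... | yes _ = f r
  ... | no _  = g r

  splice-< : ∀ {p} f g {r} → r ℕ.< p → splice p f g r ≡ f r
  splice-< {p} f g {r} r<p with r ℕ.<? p
  ... | yes _   = refl
  ... | no r≮p  = contradiction r<p r≮p

  splice-≥ : ∀ {p} f g {r} → p ℕ.≤ r → splice p f g r ≡ g r
  splice-≥ {p} f g {r} p≤r with r ℕ.<? p
  ... | yes r<p = contradiction p≤r (ℕₚ.<⇒≱ r<p)
  ... | no _    = refl

  snoc : ℕ → Seq n → Fin n → Seq n
  snoc s f y = splice (suc s) f (λ _ → y)

  snoc-≤ : ∀ {s} f y {r} → r ℕ.≤ s → snoc s f y r ≡ f r
  snoc-≤ f y r≤s = splice-< f (λ _ → y) (s≤s r≤s)

  snoc-last : ∀ s f y → snoc s f y (suc s) ≡ y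
  snoc-last s f y = splice-≥ {p = suc s} f (λ _ → y) ℕₚ.≤-refl

module _ {n} {ρ : Fin n → Fin n} where

  chain-single : ∀ {f} → Chain ρ f 0 1
  chain-single = chain λ { _ _ (s≤s ()) }

  inversion-trans : ∀ {x y z} → Inversion ρ x y → Inversion ρ y z → Inversion ρ x z
  inversion-trans (x<y , ρy<ρx) (y<z , ρz<ρy) = ℕₚ.<-trans x<y y<z , ℕₚ.<-trans ρz<ρy ρy<ρx

  chain-mono : ∀ {f lo hi lo′ hi′} → lo ℕ.≤ lo′ → hi′ ℕ.≤ hi → Chain ρ f lo hi → Chain ρ f lo′ hi′
  chain-mono lo≤lo′ hi′≤hi c =
    chain λ r lo′≤r r<hi′ → link c r (ℕₚ.≤-trans lo≤lo′ lo′≤r) (ℕₚ.<-≤-trans r<hi′ hi′≤hi)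

  chain⇒inversion : ∀ {f lo hi} → Chain ρ f lo hi → ∀ {s t} → lo ℕ.≤ s → s ℕ.< t → t ℕ.< hi →
                    Inversion ρ (f s) (f t)
  chain⇒inversion c {s} {suc t} lo≤s (s≤s s≤t) t<hi with ℕₚ.m≤n⇒m<n∨m≡n s≤t
  ... | inj₁ s<t  = inversion-trans (chain⇒inversion c lo≤s s<t (ℕₚ.<-trans (ℕₚ.n<1+n t) t<hi))
                                    (link c t (ℕₚ.≤-trans lo≤s s≤t) t<hi)
  ... | inj₂ refl = link c s lo≤s t<hi

  chain-head-max : ∀ {f hi} → Chain ρ f 0 hi → ∀ {r} → r ℕ.< hi → ρ (f r) F.≤ ρ (f 0)
  chain-head-max c {zero}  _    = ℕₚ.≤-refl
  chain-head-max c {suc r} r<hi = ℕₚ.<⇒≤ (proj₂ (chain⇒inversion c z≤n (s≤s z≤n) r<hi))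

  chain-splice : ∀ {f g lo hi} p → Chain ρ f lo p → Chain ρ g p hi →
                 (∀ {r} → suc r ≡ p → lo ℕ.≤ r → p ℕ.< hi → Inversion ρ (f r) (g p)) →
                 Chain ρ (splice p f g) lo hi
  chain-splice {f} {g} {lo} {hi} p chain-f chain-g joint = chain spliced
    where
    spliced : ∀ r → lo ℕ.≤ r → suc r ℕ.< hi → Inversion ρ (splice p f g r) (splice p f g (suc r))
    spliced r lo≤r r<hi with ℕ.<-cmp (suc r) p
    ... | tri< r+1<p _ _ = subst₂ (Inversion ρ) (sym (splice-< f g (ℕₚ.<-trans (ℕₚ.n<1+n r) r+1<p)))
                                                (sym (splice-< f g r+1<p)) (link chain-f r lo≤r r+1<p)
    ... | tri≈ _ refl _  = subst₂ (Inversion ρ) (sym (splice-< f g ℕₚ.≤-refl)) (sym (splice-≥ f g ℕₚ.≤-refl))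
                                  (joint refl lo≤r r<hi)
    ... | tri> _ _ (s≤s p≤r) = subst₂ (Inversion ρ) (sym (splice-≥ f g p≤r))
                                      (sym (splice-≥ f g (ℕₚ.m≤n⇒m≤1+n p≤r))) (link chain-g r p≤r r<hi)

  chain-snoc : ∀ {f s y} → Chain ρ f 0 (suc s) → Inversion ρ (f s) y → Chain ρ (snoc s f y) 0 (suc (suc s))
  chain-snoc {f} {s} {y} c f→y = chain-splice (suc s) c nothing-after joint
    where
    nothing-after : Chain ρ (λ _ → y) (suc s) (suc (suc s))
    nothing-after = chain λ r s<r r<s+1 → contradiction (ℕₚ.≤-pred (ℕₚ.≤-pred r<s+1)) (ℕₚ.<⇒≱ s<r)
    joint : ∀ {r} → suc r ≡ suc s → 0 ℕ.≤ r → suc s ℕ.< suc (suc s) → Inversion ρ (f r) y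
    joint refl _ _ = f→y

  chain-shift : ∀ {f lo hi} d → Chain ρ f (lo + d) (hi + d) → Chain ρ (f ∘ (_+ d)) lo hi
  chain-shift d c = chain λ r lo≤r r<hi → link c (r + d) (ℕₚ.+-monoˡ-≤ d lo≤r) (ℕₚ.+-monoˡ-< d r<hi)

  chain-unshift : ∀ {f lo hi} d → Chain ρ f lo hi → Chain ρ (f ∘ (_∸ d)) (lo + d) (hi + d)
  chain-unshift {f} {lo} {hi} d c = chain unshifted
    where
    unshifted : ∀ r → lo + d ℕ.≤ r → suc r ℕ.< hi + d → Inversion ρ (f (r ∸ d)) (f (suc r ∸ d))
    unshifted r lo+d≤r r<hi+d = subst (Inversion ρ (f (r ∸ d)) ∘ f) (sym (ℕₚ.+-∸-assoc 1 d≤r))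
        (link c (r ∸ d) (ℕₚ.+-cancelʳ-≤ d lo (r ∸ d) lo+d≤r′) (ℕₚ.+-cancelʳ-< d (suc (r ∸ d)) hi r<hi+d′))
      where
      d≤r : d ℕ.≤ r
      d≤r = ℕₚ.≤-trans (ℕₚ.m≤n+m d lo) lo+d≤r
      r∸d+d : r ∸ d + d ≡ r
      r∸d+d = ℕₚ.m∸n+n≡m d≤r
      lo+d≤r′ : lo + d ℕ.≤ r ∸ d + d
      lo+d≤r′ = subst (lo + d ℕ.≤_) (sym r∸d+d) lo+d≤r
      r<hi+d′ : suc (r ∸ d) + d ℕ.< hi + d
      r<hi+d′ = subst (λ x → suc x ℕ.< hi + d) (sym r∸d+d) r<hi+d

Occurrence : ∀ {n} → ℕ → Board n → (Fin n → Fin n) → Seq n → Set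
Occurrence k1 L ρ f = Chain ρ f 0 (suc k1) × T (L (f k1) (ρ (f 0)))

module _ {k1 : ℕ} where

  idx : ℕ → Fin (suc k1)
  idx r = r mod suc k1

  toℕ-idx : ∀ {r} → r ℕ.< suc k1 → toℕ (idx r) ≡ r
  toℕ-idx {r} r<k = trans (Fₚ.toℕ-fromℕ< _) (m<n⇒m%n≡m r<k)

  idx-toℕ : ∀ t → idx (toℕ t) ≡ t
  idx-toℕ t = Fₚ.toℕ-injective (toℕ-idx (Fₚ.toℕ<n t))

  idx-zero : idx 0 ≡ F.zero
  idx-zero = Fₚ.toℕ-injective (toℕ-idx (s≤s z≤n))

  idx-last : idx k1 ≡ fromℕ k1
  idx-last = Fₚ.toℕ-injective (trans (toℕ-idx (ℕₚ.n<1+n k1)) (sym (Fₚ.toℕ-fromℕ k1)))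

  occurrence⇒Occ : ∀ {n} L ρ {f} → Occurrence {n} k1 L ρ f → Occ (suc k1) L ρ (f ∘ toℕ)
  occurrence⇒Occ L ρ {f} (c , corner) =
    (λ s t s<t → proj₁ (inversion s<t)) , (λ s t s<t → proj₂ (inversion s<t)) ,
    subst (λ x → T (L (f x) (ρ (f 0)))) (sym (Fₚ.toℕ-fromℕ k1)) corner
    where
    inversion : ∀ {s t} → s F.< t → Inversion ρ (f (toℕ s)) (f (toℕ t))
    inversion {t = t} s<t = chain⇒inversion c z≤n s<t (Fₚ.toℕ<n t)

  Occ⇒occurrence : ∀ {n} L ρ c → Occ (suc k1) L ρ c → Occurrence {n} k1 L ρ (c ∘ idx)
  Occ⇒occurrence L ρ c (increasing , decreasing , corner) =
    chain (λ r _ r+1<k → increasing _ _ (idx-< r+1<k) , decreasing _ _ (idx-< r+1<k)) ,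
    subst₂ (λ x y → T (L (c x) (ρ (c y)))) (sym idx-last) (sym idx-zero) corner
    where
    idx-< : ∀ {r} → suc r ℕ.< suc k1 → idx r F.< idx (suc r)
    idx-< {r} r+1<k = subst₂ ℕ._<_ (sym (toℕ-idx (ℕₚ.<-trans (ℕₚ.n<1+n r) r+1<k))) (sym (toℕ-idx r+1<k))
                             (ℕₚ.n<1+n r)

module BSequence {n} (L : Board n) (ferrers : IsFerrers L) (k1 : ℕ)
  (σ : Fin n → Fin n) (σ-injective : ∀ {x y} → σ x ≡ σ y → x ≡ y)
  (b : Fin (suc k1) → Fin n) (isB : IsBSeq (suc k1) L σ b) where

  k : ℕ
  k = suc k1

  β : Seq n
  β = b ∘ idx

  τ : Fin n → Fin n
  τ = ψ k σ b

  board-mono : ∀ {x x′ y y′} → T (L x y) → x′ F.≤ x → y′ F.≤ y → T (L x′ y′)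
  board-mono = ferrers _ _ _ _

  b-Occ : Occ k L σ b
  b-Occ with isB F.zero
  ... | (c , occ , c₀≡b₀ , c≡b) , _ =
    Occ-cong k L σ (λ { F.zero → c₀≡b₀ ; (F.suc i) → c≡b (F.suc i) (s≤s z≤n) }) occ

  b-injective : ∀ {i j} → b i ≡ b j → i ≡ j
  b-injective {i} {j} bᵢ≡bⱼ with Fₚ.<-cmp i j
  ... | tri< i<j _ _ = contradiction bᵢ≡bⱼ (Fₚ.<⇒≢ (proj₁ b-Occ i j i<j))
  ... | tri≈ _ i≡j _ = i≡j
  ... | tri> _ _ j<i = contradiction (sym bᵢ≡bⱼ) (Fₚ.<⇒≢ (proj₁ b-Occ j i j<i))

  β-occurrence : Occurrence k1 L σ β
  β-occurrence = Occ⇒occurrence L σ b b-Occ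

  β-leftmost : ∀ {t} → t ℕ.< k → ∀ f → Occurrence k1 L σ f →
               (∀ {s} → t ℕ.< s → s ℕ.< k → f s ≡ β s) → β t F.≤ f t
  β-leftmost {t} t<k f occ f≡β = subst (λ x → b (idx t) F.≤ f x) (toℕ-idx t<k) leftmost
    where
    leftmost : b (idx t) F.≤ f (toℕ (idx t))
    leftmost = proj₂ (isB (idx t)) (f ∘ toℕ) (occurrence⇒Occ L σ occ) λ s t<s →
      trans (f≡β (subst (ℕ._< toℕ s) (toℕ-idx t<k) t<s) (Fₚ.toℕ<n s)) (cong b (idx-toℕ s))

  β-inversion : ∀ {p q} → p ℕ.< q → q ℕ.< k → Inversion σ (β p) (β q)
  β-inversion = chain⇒inversion (proj₁ β-occurrence) z≤n

  β-position-order : ∀ {p q} → p ℕ.< k → q ℕ.< k → β p F.< β q → p ℕ.< q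
  β-position-order {p} {q} p<k q<k βₚ<β_q with ℕ.<-cmp p q
  ... | tri< p<q _ _ = p<q
  ... | tri≈ _ refl _ = contradiction βₚ<β_q (ℕₚ.<-irrefl refl)
  ... | tri> _ _ q<p = contradiction βₚ<β_q (ℕₚ.<-asym (proj₁ (β-inversion q<p p<k)))

  β-value-order : ∀ {p q} → p ℕ.< k → q ℕ.< k → σ (β q) F.< σ (β p) → p ℕ.< q
  β-value-order {p} {q} p<k q<k σβ_q<σβₚ with ℕ.<-cmp p q
  ... | tri< p<q _ _ = p<q
  ... | tri≈ _ refl _ = contradiction σβ_q<σβₚ (ℕₚ.<-irrefl refl)
  ... | tri> _ _ q<p = contradiction σβ_q<σβₚ (ℕₚ.<-asym (proj₂ (β-inversion q<p p<k)))

  τ-β-last : τ (β k1) ≡ σ (β 0)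
  τ-β-last = begin
    τ (b (idx k1))    ≡⟨ cong (τ ∘ b) idx-last ⟩
    τ (b (fromℕ k1))  ≡⟨ ψ-last σ b ⟩
    σ (b F.zero)      ≡⟨ cong (σ ∘ b) idx-zero ⟨
    σ (β 0)           ∎
    where open ≡-Reasoning

  τ-β : ∀ {j} → suc j ℕ.< k → τ (β j) ≡ σ (β (suc j))
  τ-β {j} j+1<k = begin
    τ (b (idx j))      ≡⟨ cong (τ ∘ b) (Fₚ.toℕ-injective (trans (toℕ-idx j<k) (sym toℕ-i))) ⟩
    τ (b (inject₁ i))  ≡⟨ ψ-inner σ b b-injective i ⟩
    σ (b (F.suc i))    ≡⟨ cong (σ ∘ b) (Fₚ.toℕ-injective (trans (toℕ-idx j+1<k) (cong suc (sym toℕ-i′)))) ⟨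
    σ (β (suc j))      ∎
    where
    open ≡-Reasoning
    j<k : j ℕ.< k
    j<k = ℕₚ.<-trans (ℕₚ.n<1+n j) j+1<k
    i : Fin k1
    i = fromℕ< (ℕₚ.≤-pred j+1<k)
    toℕ-i′ : toℕ i ≡ j
    toℕ-i′ = Fₚ.toℕ-fromℕ< _
    toℕ-i : toℕ (inject₁ i) ≡ j
    toℕ-i = trans (Fₚ.toℕ-inject₁ i) toℕ-i′

  Free : Fin n → Set
  Free x = ∀ {j} → j ℕ.< k → x ≢ β j

  τ-free : ∀ {x} → Free x → τ x ≡ σ x
  τ-free {x} free = ψ-outside σ b x λ i x≡bᵢ → free (Fₚ.toℕ<n i) (trans x≡bᵢ (cong b (sym (idx-toℕ i))))

  β-index? : ∀ x → (∃ λ j → j ℕ.< k × x ≡ β j) ⊎ Free x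
  β-index? x with Fₚ.any? (λ t → x ≟ b t)
  ... | yes (t , x≡bₜ) = inj₁ (toℕ t , Fₚ.toℕ<n t , trans x≡bₜ (cong b (sym (idx-toℕ t))))
  ... | no ¬any        = inj₂ λ {j} _ x≡βⱼ → ¬any (idx j , x≡βⱼ)

  β-corner : ∀ {y} → y F.≤ σ (β 0) → T (L (β k1) y)
  β-corner = board-mono (proj₂ β-occurrence) ℕₚ.≤-refl

  -- The head bound puts (β k1 , σ (g 0)) on the board, so g can be completed by a tail of β.
  Completable : Seq n → ℕ → Set
  Completable g ℓ = Chain σ g 0 ℓ × σ (g 0) F.≤ σ (β 0)

  -- Splicing g (up to t) with the tail of β gives an occurrence agreeing with β after t
  -- whose t-th dot lies left of β t.
  β-leftmost-prefix : ∀ {t g} → t ℕ.< k → Completable g (suc t) → g t F.< β t →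
                      (suc t ℕ.< k → σ (β (suc t)) F.< σ (g t)) → ⊥
  β-leftmost-prefix {t} {g} t<k (g-chain , head≤) gₜ<βₜ above with ℕₚ.m≤n⇒m<n∨m≡n t<k
  ... | inj₁ t+1<k = ℕₚ.<⇒≱ gₜ<βₜ (subst (β t F.≤_) (splice-< g β (ℕₚ.n<1+n t)) (β-leftmost t<k f occ agree))
    where
    f : Seq n
    f = splice (suc t) g β
    joint : ∀ {r} → suc r ≡ suc t → 0 ℕ.≤ r → suc t ℕ.< k → Inversion σ (g r) (β (suc t))
    joint refl _ _ = ℕₚ.<-trans gₜ<βₜ (proj₁ (β-inversion (ℕₚ.n<1+n t) t+1<k)) , above t+1<k
    occ : Occurrence k1 L σ f
    occ = chain-splice (suc t) g-chain (chain-mono z≤n ℕₚ.≤-refl (proj₁ β-occurrence)) joint ,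
          subst₂ (λ x y → T (L x (σ y))) (sym (splice-≥ g β (ℕₚ.≤-pred t+1<k)))
                 (sym (splice-< {p = suc t} g β (s≤s z≤n)))
                 (β-corner head≤)
    agree : ∀ {s} → t ℕ.< s → s ℕ.< k → f s ≡ β s
    agree t<s _ = splice-≥ g β t<s
  ... | inj₂ refl = ℕₚ.<⇒≱ gₜ<βₜ (β-leftmost t<k g occ λ t<s s<k → contradiction (ℕₚ.≤-pred s<k) (ℕₚ.<⇒≱ t<s))
    where
    occ : Occurrence k1 L σ g
    occ = g-chain , board-mono (β-corner head≤) (ℕₚ.<⇒≤ gₜ<βₜ) ℕₚ.≤-refl

  β-leftmost-chain : ∀ {f s j} → Chain σ f 0 (suc s) → σ (f 0) F.≤ σ (β 0) → j ℕ.≤ s → j ℕ.< k →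
                     f s F.< β j → (suc j ℕ.< k → σ (β (suc j)) F.< σ (f s)) → ⊥
  β-leftmost-chain {f} {s} {j} f-chain head≤ j≤s j<k fₛ<βⱼ above =
    β-leftmost-prefix j<k (window-chain , window-head) (subst (F._< β j) (sym end) fₛ<βⱼ)
                      (subst (λ x → σ (β (suc j)) F.< σ x) (sym end) ∘ above)
    where
    δ : ℕ
    δ = s ∸ j
    j+δ≡s : j + δ ≡ s
    j+δ≡s = ℕₚ.m+[n∸m]≡n j≤s
    end : f (j + δ) ≡ f s
    end = cong f j+δ≡s
    window-chain : Chain σ (f ∘ (_+ δ)) 0 (suc j)
    window-chain = chain-shift δ (chain-mono z≤n (ℕₚ.≤-reflexive (cong suc j+δ≡s)) f-chain)
    window-head : σ (f δ) F.≤ σ (β 0)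
    window-head = ℕₚ.≤-trans (chain-head-max f-chain (s≤s (ℕₚ.m∸n≤m s j))) head≤

  β-completable : ∀ {ℓ} → ℓ ℕ.≤ k → Completable β ℓ
  β-completable ℓ≤k = chain-mono z≤n ℓ≤k (proj₁ β-occurrence) , Fₚ.≤-refl

  data Position (x : Fin n) : Set where
    inner : ∀ {j} → suc j ℕ.< k → x ≡ β j → Position x
    last  : x ≡ β k1 → Position x
    free  : Free x → Position x

  position : ∀ x → Position x
  position x with β-index? x
  ... | inj₂ x-free = free x-free
  ... | inj₁ (j , j<k , x≡βⱼ) with ℕₚ.m≤n⇒m<n∨m≡n j<k
  ...   | inj₁ j+1<k = inner j+1<k x≡βⱼ
  ...   | inj₂ refl  = last x≡βⱼ

  -- Each dot β j of e is replaced by β (j + 1), which carries the same value under τ. The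
  -- sequence built so far may then run ahead of e; `ahead` keeps a completable prefix g
  -- which stops later dots of e from slipping left of it.
  module Pullback (e : Seq n) (e-chain : Chain τ e 0 k) (τe₀<σβ₀ : τ (e 0) F.< σ (β 0)) where

    data Tracks (s : ℕ) (f : Seq n) : Set where
      same  : f s ≡ e s → Free (e s) → Tracks s f
      ahead : ∀ {t} (g : Seq n) → s ℕ.≤ t → suc t ℕ.< k → f s ≡ β (suc t) → e s F.< β (suc t) →
              τ (e s) F.≤ σ (β (suc t)) → Completable g (suc t) → g t F.≤ e s → τ (e s) F.≤ σ (g t) →
              Tracks s f

    Pulled : ℕ → Set
    Pulled s = ∃ λ f → Chain σ f 0 (suc s) × σ (f 0) ≡ τ (e 0) × Tracks s f

    e-not-last : ∀ {s} → s ℕ.< k → e s ≢ β k1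
    e-not-last s<k eₛ≡β = Fₚ.<-irrefl (trans (cong τ eₛ≡β) τ-β-last)
                                      (ℕₚ.≤-<-trans (chain-head-max e-chain s<k) τe₀<σβ₀)

    ahead-at-β : ∀ {s j f} → s ℕ.≤ j → suc j ℕ.< k → f s ≡ β (suc j) → e s ≡ β j → Tracks s f
    ahead-at-β {s} {j} s≤j j+1<k fₛ≡βⱼ₊₁ eₛ≡βⱼ =
      ahead β s≤j j+1<k fₛ≡βⱼ₊₁ (subst (F._< β (suc j)) (sym eₛ≡βⱼ) (proj₁ βⱼ→βⱼ₊₁))
            (Fₚ.≤-reflexive τeₛ) (β-completable (ℕₚ.<⇒≤ j+1<k)) (Fₚ.≤-reflexive (sym eₛ≡βⱼ))
            (ℕₚ.<⇒≤ (subst (F._< σ (β j)) (sym τeₛ) (proj₂ βⱼ→βⱼ₊₁)))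
      where
      βⱼ→βⱼ₊₁ : Inversion σ (β j) (β (suc j))
      βⱼ→βⱼ₊₁ = β-inversion (ℕₚ.n<1+n j) j+1<k
      τeₛ : τ (e s) ≡ σ (β (suc j))
      τeₛ = trans (cong τ eₛ≡βⱼ) (τ-β j+1<k)

    pulled-zero : Pulled 0
    pulled-zero with position (e 0)
    ... | last e₀≡β           = ⊥-elim (e-not-last (s≤s z≤n) e₀≡β)
    ... | free e₀-free        = (λ _ → e 0) , chain-single , sym (τ-free e₀-free) , same refl e₀-free
    ... | inner {j} j+1<k e₀≡βⱼ =
      (λ _ → β (suc j)) , chain-single , sym (trans (cong τ e₀≡βⱼ) (τ-β j+1<k)) ,
      ahead-at-β z≤n j+1<k refl e₀≡βⱼ

    pull-to-β : ∀ {s j} → suc s ℕ.< k → suc j ℕ.< k → e (suc s) ≡ β j → Pulled s → Pulled (suc s)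
    pull-to-β {s} {j} s+1<k j+1<k eₛ₊₁≡βⱼ (f , f-chain , σf₀ , tracks) =
      snoc s f y , chain-snoc f-chain (proj₂ (advance tracks)) , trans (cong σ (snoc-≤ {s = s} f y z≤n)) σf₀ ,
      ahead-at-β (proj₁ (advance tracks)) j+1<k (snoc-last s f y) eₛ₊₁≡βⱼ
      where
      y : Fin n
      y = β (suc j)
      eₛ→eₛ₊₁ : Inversion τ (e s) (e (suc s))
      eₛ→eₛ₊₁ = link e-chain s z≤n s+1<k
      σy<τeₛ : σ y F.< τ (e s)
      σy<τeₛ = subst (F._< τ (e s)) (trans (cong τ eₛ₊₁≡βⱼ) (τ-β j+1<k)) (proj₂ eₛ→eₛ₊₁)
      advance : Tracks s f → s ℕ.< j × Inversion σ (f s) y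
      advance (same fₛ≡eₛ eₛ-free) = s<j , ℕₚ.<-trans fₛ<βⱼ (proj₁ (β-inversion (ℕₚ.n<1+n j) j+1<k)) , above
        where
        fₛ<βⱼ : f s F.< β j
        fₛ<βⱼ = subst₂ F._<_ (sym fₛ≡eₛ) eₛ₊₁≡βⱼ (proj₁ eₛ→eₛ₊₁)
        above : σ y F.< σ (f s)
        above = subst (σ y F.<_) (trans (τ-free eₛ-free) (cong σ (sym fₛ≡eₛ))) σy<τeₛ
        s<j : s ℕ.< j
        s<j = ℕₚ.≰⇒> λ j≤s → β-leftmost-chain f-chain (ℕₚ.≤-trans (Fₚ.≤-reflexive σf₀) (ℕₚ.<⇒≤ τe₀<σβ₀))
                                                 j≤s (ℕₚ.<-trans (ℕₚ.n<1+n j) j+1<k) fₛ<βⱼ (λ _ → above)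
      advance (ahead {t} _ s≤t t+1<k fₛ≡βₜ₊₁ _ τeₛ≤σβₜ₊₁ _ _ _) =
        ℕₚ.≤-<-trans s≤t (ℕₚ.≤-pred t+1<j+1) ,
        subst (λ z → Inversion σ z y) (sym fₛ≡βₜ₊₁) (β-inversion t+1<j+1 j+1<k)
        where
        t+1<j+1 : suc t ℕ.< suc j
        t+1<j+1 = β-value-order t+1<k j+1<k (ℕₚ.<-≤-trans σy<τeₛ τeₛ≤σβₜ₊₁)

    pull-free : ∀ {s} → suc s ℕ.< k → Free (e (suc s)) → Pulled s → Pulled (suc s)
    pull-free {s} s+1<k x-free (f , f-chain , σf₀ , tracks) = continue tracks
      where
      x : Fin n
      x = e (suc s)
      eₛ→x : Inversion τ (e s) x
      eₛ→x = link e-chain s z≤n s+1<k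
      σx≡τx : σ x ≡ τ x
      σx≡τx = sym (τ-free x-free)
      σx<τeₛ : σ x F.< τ (e s)
      σx<τeₛ = subst (F._< τ (e s)) (sym σx≡τx) (proj₂ eₛ→x)

      extend : ∀ y → Inversion σ (f s) y → Tracks (suc s) (snoc s f y) → Pulled (suc s)
      extend y fₛ→y tracks′ =
        snoc s f y , chain-snoc f-chain fₛ→y , trans (cong σ (snoc-≤ {s = s} f y z≤n)) σf₀ , tracks′

      stay : Inversion σ (f s) x → Pulled (suc s)
      stay fₛ→x = extend x fₛ→x (same (snoc-last s f x) x-free)

      overtake : ∀ {t} (g : Seq n) → s ℕ.≤ t → suc t ℕ.< k → f s ≡ β (suc t) → x F.< β (suc t) →
                 Completable g (suc t) → g t F.≤ e s → τ (e s) F.≤ σ (g t) → Pulled (suc s)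
      overtake {t} g s≤t t+1<k fₛ≡βₜ₊₁ x<βₜ₊₁ (g-chain , σg₀≤) gₜ≤eₛ τeₛ≤σgₜ = decide (suc (suc t) ℕ.<? k)
        where
        g′ : Seq n
        g′ = snoc t g x
        g′-completable : Completable g′ (suc (suc t))
        g′-completable = chain-snoc g-chain (ℕₚ.≤-<-trans gₜ≤eₛ (proj₁ eₛ→x) , ℕₚ.<-≤-trans σx<τeₛ τeₛ≤σgₜ) ,
                         subst (λ z → σ z F.≤ σ (β 0)) (sym (snoc-≤ {s = t} g x z≤n)) σg₀≤
        blocked : (suc (suc t) ℕ.< k → σ (β (suc (suc t))) F.< σ (g′ (suc t))) → ⊥
        blocked = β-leftmost-prefix t+1<k g′-completable (subst (F._< β (suc t)) (sym (snoc-last t g x)) x<βₜ₊₁)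
        decide : Dec (suc (suc t) ℕ.< k) → Pulled (suc s)
        decide (no t+2≮k) = ⊥-elim (blocked λ t+2<k → contradiction t+2<k t+2≮k)
        decide (yes t+2<k) with Fₚ.<-cmp (σ x) (σ (β (suc (suc t))))
        ... | tri> _ _ σx>σβₜ₊₂ =
          ⊥-elim (blocked λ _ → subst (λ z → _ F.< σ z) (sym (snoc-last t g x)) σx>σβₜ₊₂)
        ... | tri≈ _ σx≡σβₜ₊₂ _ = ⊥-elim (x-free t+2<k (σ-injective σx≡σβₜ₊₂))
        ... | tri< σx<σβₜ₊₂ _ _ =
          extend y (subst (λ z → Inversion σ z y) (sym fₛ≡βₜ₊₁) βₜ₊₁→βₜ₊₂)
            (ahead g′ (s≤s s≤t) t+2<k (snoc-last s f y) (ℕₚ.<-trans x<βₜ₊₁ (proj₁ βₜ₊₁→βₜ₊₂))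
                   (ℕₚ.<⇒≤ (subst (F._< σ y) σx≡τx σx<σβₜ₊₂)) g′-completable
                   (Fₚ.≤-reflexive (snoc-last t g x))
                   (Fₚ.≤-reflexive (trans (sym σx≡τx) (cong σ (sym (snoc-last t g x))))))
          where
          y : Fin n
          y = β (suc (suc t))
          βₜ₊₁→βₜ₊₂ : Inversion σ (β (suc t)) y
          βₜ₊₁→βₜ₊₂ = β-inversion (ℕₚ.n<1+n (suc t)) t+2<k

      continue : Tracks s f → Pulled (suc s)
      continue (same fₛ≡eₛ eₛ-free) =
        stay (subst (F._< x) (sym fₛ≡eₛ) (proj₁ eₛ→x) ,
              subst (σ x F.<_) (trans (τ-free eₛ-free) (cong σ (sym fₛ≡eₛ))) σx<τeₛ)
      continue (ahead {t} g s≤t t+1<k fₛ≡βₜ₊₁ _ τeₛ≤σβₜ₊₁ g-completable gₜ≤eₛ τeₛ≤σgₜ)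
        with Fₚ.<-cmp x (β (suc t))
      ... | tri< x<βₜ₊₁ _ _ = overtake g s≤t t+1<k fₛ≡βₜ₊₁ x<βₜ₊₁ g-completable gₜ≤eₛ τeₛ≤σgₜ
      ... | tri≈ _ x≡βₜ₊₁ _ = ⊥-elim (x-free t+1<k x≡βₜ₊₁)
      ... | tri> _ _ βₜ₊₁<x = stay (subst (F._< x) (sym fₛ≡βₜ₊₁) βₜ₊₁<x ,
                                    subst (σ x F.<_) (cong σ (sym fₛ≡βₜ₊₁)) (ℕₚ.<-≤-trans σx<τeₛ τeₛ≤σβₜ₊₁))

    pulled : ∀ s → s ℕ.< k → Pulled s
    pulled zero    _     = pulled-zero
    pulled (suc s) s+1<k with position (e (suc s))
    ... | inner j+1<k eₛ₊₁≡βⱼ = pull-to-β s+1<k j+1<k eₛ₊₁≡βⱼ (pulled s (ℕₚ.<-trans (ℕₚ.n<1+n s) s+1<k))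
    ... | last eₛ₊₁≡β         = ⊥-elim (e-not-last s+1<k eₛ₊₁≡β)
    ... | free x-free         = pull-free s+1<k x-free (pulled s (ℕₚ.<-trans (ℕₚ.n<1+n s) s+1<k))

    pullback : ∃ λ f → Chain σ f 0 k × σ (f 0) ≡ τ (e 0) × f k1 ≡ e k1
    pullback with pulled k1 (ℕₚ.n<1+n k1)
    ... | f , f-chain , σf₀ , same fₖ≡eₖ _ = f , f-chain , σf₀ , fₖ≡eₖ
    ... | _ , _ , _ , ahead _ k1≤t t+1<k _ _ _ _ _ _ = contradiction k1≤t (ℕₚ.<⇒≱ (ℕₚ.≤-pred t+1<k))

  module ASequence (a : Fin k → Fin n) (isA : IsASeq k L σ a) where

    α : Seq n
    α = a ∘ idx

    m : Fin n
    m = σ (α 0)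

    α-occurrence : Occurrence k1 L σ α
    α-occurrence = Occ⇒occurrence L σ a (proj₁ isA)

    α-inversion : ∀ {p q} → p ℕ.< q → q ℕ.< k → Inversion σ (α p) (α q)
    α-inversion = chain⇒inversion (proj₁ α-occurrence) z≤n

    α-lex-minimal : ∀ {t} f → Occurrence k1 L σ f → t ℕ.< k → σ (f t) F.< σ (α t) →
                    (∀ {s} → s ℕ.< t → f s ≡ α s) → ⊥
    α-lex-minimal {t} f occ t<k below agree = proj₂ isA (f ∘ toℕ) (occurrence⇒Occ L σ occ)
      (idx t , subst (λ x → σ (f x) F.< σ (α t)) (sym (toℕ-idx t<k)) below ,
       λ s s<t → cong σ (trans (agree (subst (toℕ s ℕ.<_) (toℕ-idx t<k) s<t)) (cong a (idx-toℕ s))))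

    m≤σβ₀ : m F.≤ σ (β 0)
    m≤σβ₀ = ℕₚ.≮⇒≥ λ σβ₀<m → α-lex-minimal β β-occurrence (s≤s z≤n) σβ₀<m λ ()

    α-completable : ∀ {ℓ} → ℓ ℕ.≤ k → Completable α ℓ
    α-completable ℓ≤k = chain-mono z≤n ℓ≤k (proj₁ α-occurrence) , m≤σβ₀

    α-index-≢-β : ∀ {i j} → j ℕ.< i → i ℕ.< k → α i ≢ β j
    α-index-≢-β {suc i} {j} (s≤s j≤i) i+1<k αᵢ₊₁≡βⱼ =
      β-leftmost-chain (proj₁ (α-completable (ℕₚ.<⇒≤ i+1<k))) m≤σβ₀ j≤i (ℕₚ.≤-<-trans j≤i i<k)
        (subst (α i F.<_) αᵢ₊₁≡βⱼ (proj₁ αᵢ→αᵢ₊₁))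
        λ j+1<k → ℕₚ.<-trans (proj₂ (β-inversion (ℕₚ.n<1+n j) j+1<k))
                             (subst (λ z → σ z F.< σ (α i)) αᵢ₊₁≡βⱼ (proj₂ αᵢ→αᵢ₊₁))
      where
      i<k : i ℕ.< k
      i<k = ℕₚ.<-trans (ℕₚ.n<1+n i) i+1<k
      αᵢ→αᵢ₊₁ : Inversion σ (α i) (α (suc i))
      αᵢ→αᵢ₊₁ = α-inversion (ℕₚ.n<1+n i) i+1<k

    α≡β⇒index≤ : ∀ {i j} → i ℕ.< k → α i ≡ β j → i ℕ.≤ j
    α≡β⇒index≤ i<k αᵢ≡βⱼ = ℕₚ.≮⇒≥ λ j<i → α-index-≢-β j<i i<k αᵢ≡βⱼ

    module SameFirstDot (α₀≡β₀ : α 0 ≡ β 0) where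

      σβ₁<m : 1 ℕ.< k → σ (β 1) F.< m
      σβ₁<m 1<k = subst (σ (β 1) F.<_) (cong σ (sym α₀≡β₀)) (proj₂ (β-inversion (s≤s z≤n) 1<k))

      -- Otherwise β 1, …, β s, α s, …, α k1 would be an occurrence starting below m.
      drop⇒α-left : ∀ {s} → 1 ℕ.≤ s → s ℕ.< k → σ (α s) F.< σ (β s) → α s F.< β s
      drop⇒α-left {s} 1≤s s<k σαₛ<σβₛ with Fₚ.<-cmp (α s) (β s)
      ... | tri< αₛ<βₛ _ _ = αₛ<βₛ
      ... | tri≈ _ αₛ≡βₛ _ = ⊥-elim (Fₚ.<-irrefl (cong σ αₛ≡βₛ) σαₛ<σβₛ)
      ... | tri> _ _ βₛ<αₛ = ⊥-elim (α-lex-minimal f (f-chain , f-corner) (s≤s z≤n) f₀<m λ ())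
        where
        s≤k1 : s ℕ.≤ k1
        s≤k1 = ℕₚ.≤-pred s<k
        1<k : 1 ℕ.< k
        1<k = s≤s (ℕₚ.≤-trans 1≤s s≤k1)
        f : Seq n
        f = splice s (β ∘ (_+ 1)) α
        f₀≡β₁ : f 0 ≡ β 1
        f₀≡β₁ = splice-< (β ∘ (_+ 1)) α 1≤s
        f₀<m : σ (f 0) F.< m
        f₀<m = subst (λ z → σ z F.< m) (sym f₀≡β₁) (σβ₁<m 1<k)
        joint : ∀ {r} → suc r ≡ s → 0 ℕ.≤ r → s ℕ.< k → Inversion σ (β (r + 1)) (α s)
        joint {r} r+1≡s _ _ = subst (λ z → Inversion σ (β z) (α s)) (sym (trans (ℕₚ.+-comm r 1) r+1≡s))
                                    (βₛ<αₛ , σαₛ<σβₛ)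
        f-chain : Chain σ f 0 k
        f-chain = chain-splice s (chain-shift 1 (chain-mono z≤n (subst (ℕ._≤ k) (ℕₚ.+-comm 1 s) s<k)
                                                            (proj₁ β-occurrence)))
                               (chain-mono z≤n ℕₚ.≤-refl (proj₁ α-occurrence)) joint
        f-corner : T (L (f k1) (σ (f 0)))
        f-corner = subst₂ (λ x y → T (L x (σ y))) (sym (splice-≥ (β ∘ (_+ 1)) α s≤k1)) (sym f₀≡β₁)
                          (board-mono (proj₂ α-occurrence) ℕₚ.≤-refl (ℕₚ.<⇒≤ (σβ₁<m 1<k)))

      drop-propagates : ∀ {s} → 1 ℕ.≤ s → s ℕ.< k → σ (α s) F.< σ (β s) →
                        suc s ℕ.< k × σ (α (suc s)) F.< σ (β (suc s))
      drop-propagates {s} 1≤s s<k σαₛ<σβₛ = decide (suc s ℕ.<? k)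
        where
        αₛ<βₛ : α s F.< β s
        αₛ<βₛ = drop⇒α-left 1≤s s<k σαₛ<σβₛ
        blocked : (suc s ℕ.< k → σ (β (suc s)) F.< σ (α s)) → ⊥
        blocked = β-leftmost-prefix s<k (α-completable s<k) αₛ<βₛ
        decide : Dec (suc s ℕ.< k) → suc s ℕ.< k × σ (α (suc s)) F.< σ (β (suc s))
        decide (no s+1≮k) = ⊥-elim (blocked λ s+1<k → contradiction s+1<k s+1≮k)
        decide (yes s+1<k) with Fₚ.<-cmp (σ (α s)) (σ (β (suc s)))
        ... | tri< σαₛ<σβₛ₊₁ _ _ = s+1<k , ℕₚ.<-trans (proj₂ (α-inversion (ℕₚ.n<1+n s) s+1<k)) σαₛ<σβₛ₊₁
        ... | tri≈ _ σαₛ≡σβₛ₊₁ _ = ⊥-elim (Fₚ.<-irrefl (σ-injective σαₛ≡σβₛ₊₁)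
                                             (ℕₚ.<-trans αₛ<βₛ (proj₁ (β-inversion (ℕₚ.n<1+n s) s+1<k))))
        ... | tri> _ _ σαₛ>σβₛ₊₁ = ⊥-elim (blocked λ _ → σαₛ>σβₛ₊₁)

      no-drop : ∀ d {s} → s + d ≡ k1 → 1 ℕ.≤ s → σ (α s) F.< σ (β s) → ⊥
      no-drop d {s} s+d≡k1 1≤s σαₛ<σβₛ
        with drop-propagates 1≤s (s≤s (subst (s ℕ.≤_) s+d≡k1 (ℕₚ.m≤m+n s d))) σαₛ<σβₛ
      no-drop zero    {s} s+0≡k1 _ _ | s+1<k , _ =
        ℕₚ.<-irrefl (cong suc (trans (sym (ℕₚ.+-identityʳ s)) s+0≡k1)) s+1<k
      no-drop (suc d) {s} s+d+1≡k1 1≤s _ | _ , σαₛ₊₁<σβₛ₊₁ =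
        no-drop d (trans (sym (ℕₚ.+-suc s d)) s+d+1≡k1) (ℕₚ.m≤n⇒m≤1+n 1≤s) σαₛ₊₁<σβₛ₊₁

      α≡β-at : ∀ {u} → u ℕ.< k → (∀ {s} → s ℕ.< u → α s ≡ β s) → α u ≡ β u
      α≡β-at {zero}  _   _     = α₀≡β₀
      α≡β-at {suc u} u<k agree with Fₚ.<-cmp (σ (α (suc u))) (σ (β (suc u)))
      ... | tri< below _ _ = ⊥-elim (no-drop (k1 ∸ suc u) (ℕₚ.m+[n∸m]≡n (ℕₚ.≤-pred u<k)) (s≤s z≤n) below)
      ... | tri≈ _ same _  = σ-injective same
      ... | tri> _ _ above = ⊥-elim (α-lex-minimal β β-occurrence u<k above (sym ∘ agree))

      α≡β-below : ∀ u → u ℕ.≤ k → ∀ {s} → s ℕ.< u → α s ≡ β s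
      α≡β-below (suc u) u<k {s} s<u+1 with ℕₚ.m≤n⇒m<n∨m≡n (ℕₚ.≤-pred s<u+1)
      ... | inj₁ s<u  = α≡β-below u (ℕₚ.<⇒≤ u<k) s<u
      ... | inj₂ refl = α≡β-at u<k (α≡β-below u (ℕₚ.<⇒≤ u<k))

    module Meeting (i δ : ℕ) (j+1<k : suc (i + δ) ℕ.< k) (αᵢ₊₁≡βⱼ₊₁ : α (suc i) ≡ β (suc (i + δ))) where

      i+1<k : suc i ℕ.< k
      i+1<k = ℕₚ.≤-<-trans (s≤s (ℕₚ.m≤m+n i δ)) j+1<k

      αᵢ→αᵢ₊₁ : Inversion σ (α i) (α (suc i))
      αᵢ→αᵢ₊₁ = α-inversion (ℕₚ.n<1+n i) i+1<k

      -- Otherwise β 0, …, β (t + δ), α t, …, α i would be a completable prefix ending left of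
      -- β (i + δ + 1).
      crossing-value : ∀ {t} → t ℕ.≤ i → β (t + δ) F.< α t → σ (β (t + δ)) F.< σ (α t)
      crossing-value {t} t≤i βₜ₊δ<αₜ with Fₚ.<-cmp (σ (β (t + δ))) (σ (α t))
      ... | tri< above _ _ = above
      ... | tri≈ _ same _  = ⊥-elim (Fₚ.<-irrefl (σ-injective same) βₜ₊δ<αₜ)
      ... | tri> _ _ below =
        ⊥-elim (β-leftmost-prefix j+1<k (Z-chain , Fₚ.≤-reflexive (cong σ Z₀≡β₀)) Zⱼ₊₁<βⱼ₊₁ Z-above)
        where
        Z : Seq n
        Z = splice (suc (t + δ)) β (α ∘ (_∸ suc δ))
        Z₀≡β₀ : Z 0 ≡ β 0
        Z₀≡β₀ = splice-< {p = suc (t + δ)} β (α ∘ (_∸ suc δ)) (s≤s z≤n)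
        Zⱼ₊₁≡αᵢ : Z (suc (i + δ)) ≡ α i
        Zⱼ₊₁≡αᵢ = trans (splice-≥ β (α ∘ (_∸ suc δ)) (s≤s (ℕₚ.+-monoˡ-≤ δ t≤i))) (cong α (ℕₚ.m+n∸n≡m i δ))
        α-tail : Chain σ (α ∘ (_∸ suc δ)) (suc (t + δ)) (suc (suc (i + δ)))
        α-tail = subst₂ (Chain σ (α ∘ (_∸ suc δ))) (ℕₚ.+-suc t δ) (cong suc (ℕₚ.+-suc i δ))
                        (chain-unshift (suc δ) (chain-mono z≤n (ℕₚ.<⇒≤ i+1<k) (proj₁ α-occurrence)))
        joint : ∀ {r} → suc r ≡ suc (t + δ) → 0 ℕ.≤ r → suc (t + δ) ℕ.< suc (suc (i + δ)) →
                Inversion σ (β r) (α (t + δ ∸ δ))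
        joint refl _ _ = subst (Inversion σ (β (t + δ)) ∘ α) (sym (ℕₚ.m+n∸n≡m t δ)) (βₜ₊δ<αₜ , below)
        Z-chain : Chain σ Z 0 (suc (suc (i + δ)))
        Z-chain = chain-splice (suc (t + δ))
                    (chain-mono z≤n (ℕₚ.≤-trans (s≤s (ℕₚ.+-monoˡ-≤ δ t≤i)) (ℕₚ.<⇒≤ j+1<k)) (proj₁ β-occurrence))
                    α-tail joint
        Zⱼ₊₁<βⱼ₊₁ : Z (suc (i + δ)) F.< β (suc (i + δ))
        Zⱼ₊₁<βⱼ₊₁ = subst₂ F._<_ (sym Zⱼ₊₁≡αᵢ) αᵢ₊₁≡βⱼ₊₁ (proj₁ αᵢ→αᵢ₊₁)
        Z-above : suc (suc (i + δ)) ℕ.< k → σ (β (suc (suc (i + δ)))) F.< σ (Z (suc (i + δ)))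
        Z-above j+2<k = subst (λ z → σ (β (suc (suc (i + δ)))) F.< σ z) (sym Zⱼ₊₁≡αᵢ)
          (ℕₚ.<-trans (proj₂ (β-inversion (ℕₚ.n<1+n _) j+2<k))
                      (subst (λ z → σ z F.< σ (α i)) αᵢ₊₁≡βⱼ₊₁ (proj₂ αᵢ→αᵢ₊₁)))

      -- Replacing α t, …, α i by β (t + δ), …, β (i + δ) gives an occurrence lexicographically below α.
      first-crossing : ∀ {t} → t ℕ.≤ i → β (t + δ) F.< α t → (∀ {r} → suc r ≡ t → α r F.≤ β (r + δ)) → ⊥
      first-crossing {t} t≤i βₜ₊δ<αₜ before =
        α-lex-minimal S (S-chain , S-corner) t<k S-below (splice-< α middle)
        where
        above : σ (β (t + δ)) F.< σ (α t)
        above = crossing-value t≤i βₜ₊δ<αₜ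
        t<k : t ℕ.< k
        t<k = ℕₚ.≤-<-trans t≤i (ℕₚ.<-trans (ℕₚ.n<1+n i) i+1<k)
        middle : Seq n
        middle = splice (suc i) (β ∘ (_+ δ)) α
        S : Seq n
        S = splice t α middle
        middleₜ≡βₜ₊δ : middle t ≡ β (t + δ)
        middleₜ≡βₜ₊δ = splice-< (β ∘ (_+ δ)) α (s≤s t≤i)
        middle-joint : ∀ {r} → suc r ≡ suc i → t ℕ.≤ r → suc i ℕ.< k → Inversion σ (β (r + δ)) (α (suc i))
        middle-joint refl _ _ = subst (Inversion σ (β (i + δ))) (sym αᵢ₊₁≡βⱼ₊₁) (β-inversion (ℕₚ.n<1+n _) j+1<k)
        middle-chain : Chain σ middle t k
        middle-chain = chain-splice (suc i) (chain-shift δ (chain-mono z≤n (ℕₚ.<⇒≤ j+1<k) (proj₁ β-occurrence)))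
                                    (chain-mono z≤n ℕₚ.≤-refl (proj₁ α-occurrence)) middle-joint
        S-joint : ∀ {r} → suc r ≡ t → 0 ℕ.≤ r → t ℕ.< k → Inversion σ (α r) (middle t)
        S-joint {r} r+1≡t _ _ = subst (Inversion σ (α r)) (sym middleₜ≡βₜ₊δ)
          (ℕₚ.≤-<-trans (before r+1≡t) (proj₁ (β-inversion (ℕₚ.+-monoˡ-< δ r<t) t+δ<k)) ,
           ℕₚ.<-trans above (proj₂ (α-inversion r<t t<k)))
          where
          r<t : r ℕ.< t
          r<t = subst (r ℕ.<_) r+1≡t (ℕₚ.n<1+n r)
          t+δ<k : t + δ ℕ.< k
          t+δ<k = ℕₚ.≤-<-trans (ℕₚ.+-monoˡ-≤ δ t≤i) (ℕₚ.<-trans (ℕₚ.n<1+n _) j+1<k)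
        S-chain : Chain σ S 0 k
        S-chain = chain-splice t (chain-mono z≤n (ℕₚ.<⇒≤ t<k) (proj₁ α-occurrence)) middle-chain S-joint
        Sₖ≡αₖ : S k1 ≡ α k1
        Sₖ≡αₖ = trans (splice-≥ α middle (ℕₚ.≤-pred t<k)) (splice-≥ (β ∘ (_+ δ)) α (ℕₚ.≤-pred i+1<k))
        S₀≤m : σ (S 0) F.≤ m
        S₀≤m with ℕₚ.m≤n⇒m<n∨m≡n (z≤n {t})
        ... | inj₁ 0<t = Fₚ.≤-reflexive (cong σ (splice-< α middle 0<t))
        ... | inj₂ 0≡t = ℕₚ.<⇒≤ (subst (λ z → σ z F.< m) (sym S₀≡βδ)
                                       (subst (λ z → σ (β (z + δ)) F.< σ (α z)) (sym 0≡t) above))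
          where
          S₀≡βδ : S 0 ≡ β δ
          S₀≡βδ = trans (splice-≥ α middle (ℕₚ.≤-reflexive (sym 0≡t)))
                        (splice-< {p = suc i} (β ∘ (_+ δ)) α (s≤s z≤n))
        S-corner : T (L (S k1) (σ (S 0)))
        S-corner = subst (λ x → T (L x (σ (S 0)))) (sym Sₖ≡αₖ) (board-mono (proj₂ α-occurrence) ℕₚ.≤-refl S₀≤m)
        S-below : σ (S t) F.< σ (α t)
        S-below = subst (λ z → σ z F.< σ (α t))
                        (sym (trans (splice-≥ {p = t} α middle ℕₚ.≤-refl) middleₜ≡βₜ₊δ)) above

      never-crossed : ∀ t → t ℕ.≤ i → β (t + δ) F.< α t → ⊥
      never-crossed zero    t≤i βδ<α₀ = first-crossing t≤i βδ<α₀ λ ()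
      never-crossed (suc t) t≤i βₜ₊₁₊δ<αₜ₊₁ with Fₚ.<-cmp (β (t + δ)) (α t)
      ... | tri< βₜ₊δ<αₜ _ _ = never-crossed t (ℕₚ.≤-trans (ℕₚ.n≤1+n t) t≤i) βₜ₊δ<αₜ
      ... | tri≈ _ βₜ₊δ≡αₜ _ = first-crossing t≤i βₜ₊₁₊δ<αₜ₊₁ λ { refl → Fₚ.≤-reflexive (sym βₜ₊δ≡αₜ) }
      ... | tri> _ _ αₜ<βₜ₊δ = first-crossing t≤i βₜ₊₁₊δ<αₜ₊₁ λ { refl → ℕₚ.<⇒≤ αₜ<βₜ₊δ }

    α≤β-before-meeting : ∀ {i j} → i ℕ.≤ j → suc j ℕ.< k → α (suc i) ≡ β (suc j) → α i F.≤ β j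
    α≤β-before-meeting {i} {j} i≤j j+1<k meet with j ∸ i | ℕₚ.m+[n∸m]≡n i≤j
    ... | δ | refl = ℕₚ.≮⇒≥ (Meeting.never-crossed i δ j+1<k meet i ℕₚ.≤-refl)

    τ-occurrence-head≥m : ∀ e → Occurrence k1 L τ e → m F.≤ τ (e 0)
    τ-occurrence-head≥m e (e-chain , corner) with Fₚ.<-cmp (τ (e 0)) (σ (β 0))
    ... | tri≈ _ τe₀≡σβ₀ _ = subst (m F.≤_) (sym τe₀≡σβ₀) m≤σβ₀
    ... | tri> _ _ σβ₀<τe₀ = ℕₚ.≤-trans m≤σβ₀ (ℕₚ.<⇒≤ σβ₀<τe₀)
    ... | tri< τe₀<σβ₀ _ _ with Pullback.pullback e e-chain τe₀<σβ₀
    ...   | f , f-chain , σf₀≡τe₀ , fₖ≡eₖ = subst (m F.≤_) σf₀≡τe₀ (ℕₚ.≮⇒≥ λ σf₀<m →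
            α-lex-minimal f (f-chain , subst₂ (λ x y → T (L x y)) (sym fₖ≡eₖ) (sym σf₀≡τe₀) corner)
                          (s≤s z≤n) σf₀<m λ ())

    -- α↓ moves each dot β (j + 1) of α to β j, which ψ gives the value of β (j + 1); so τ ∘ α↓ = σ ∘ α.
    -- Only a dot β 0 cannot move, and only α 0 could be one.
    module Shifted (α₀≢β₀ : α 0 ≢ β 0) where

      α↓ : Seq n
      α↓ r with β-index? (α r)
      ... | inj₁ (suc j , _) = β j
      ... | _                = α r

      data Shift (r : ℕ) : Fin n → Set where
        kept  : Free (α r) → Shift r (α r)
        moved : ∀ {j} → suc j ℕ.< k → α r ≡ β (suc j) → Shift r (β j)

      α↓-shift : ∀ {r} → r ℕ.< k → Shift r (α↓ r)
      α↓-shift {r} r<k with β-index? (α r)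
      ... | inj₂ αᵣ-free                 = kept αᵣ-free
      ... | inj₁ (suc j , j+1<k , αᵣ≡βⱼ₊₁) = moved j+1<k αᵣ≡βⱼ₊₁
      ... | inj₁ (zero , _ , αᵣ≡β₀)       =
        ⊥-elim (α₀≢β₀ (subst (λ z → α z ≡ β 0) (ℕₚ.n≤0⇒n≡0 (α≡β⇒index≤ r<k αᵣ≡β₀)) αᵣ≡β₀))

      τ-shift : ∀ {r y} → Shift r y → τ y ≡ σ (α r)
      τ-shift (kept αᵣ-free)          = τ-free αᵣ-free
      τ-shift (moved j+1<k αᵣ≡βⱼ₊₁) = trans (τ-β j+1<k) (cong σ (sym αᵣ≡βⱼ₊₁))

      shift-≤ : ∀ {r y} → Shift r y → y F.≤ α r
      shift-≤ (kept _)                     = ℕₚ.≤-refl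
      shift-≤ (moved {j} j+1<k αᵣ≡βⱼ₊₁) =
        ℕₚ.<⇒≤ (subst (β j F.<_) (sym αᵣ≡βⱼ₊₁) (proj₁ (β-inversion (ℕₚ.n<1+n j) j+1<k)))

      shift-< : ∀ {r y y′} → suc r ℕ.< k → Shift r y → Shift (suc r) y′ → y F.< y′
      shift-< {r} r+1<k (kept _) (kept _) = proj₁ (α-inversion (ℕₚ.n<1+n r) r+1<k)
      shift-< {r} r+1<k (moved {j} j+1<k αᵣ≡βⱼ₊₁) (kept _) =
        ℕₚ.<-trans (subst (β j F.<_) (sym αᵣ≡βⱼ₊₁) (proj₁ (β-inversion (ℕₚ.n<1+n j) j+1<k)))
                   (proj₁ (α-inversion (ℕₚ.n<1+n r) r+1<k))
      shift-< {r} r+1<k (moved {j} j+1<k αᵣ≡βⱼ₊₁) (moved {j′} j′+1<k αᵣ₊₁≡βⱼ′₊₁) =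
        proj₁ (β-inversion (ℕₚ.≤-pred j+1<j′+1) (ℕₚ.<-trans (ℕₚ.n<1+n j′) j′+1<k))
        where
        j+1<j′+1 : suc j ℕ.< suc j′
        j+1<j′+1 = β-position-order j+1<k j′+1<k
                     (subst₂ F._<_ αᵣ≡βⱼ₊₁ αᵣ₊₁≡βⱼ′₊₁ (proj₁ (α-inversion (ℕₚ.n<1+n r) r+1<k)))
      shift-< {r} r+1<k (kept αᵣ-free) (moved {j′} j′+1<k αᵣ₊₁≡βⱼ′₊₁) =
        Fₚ.≤∧≢⇒< (α≤β-before-meeting r≤j′ j′+1<k αᵣ₊₁≡βⱼ′₊₁) (αᵣ-free (ℕₚ.<-trans (ℕₚ.n<1+n j′) j′+1<k))
        where
        r≤j′ : r ℕ.≤ j′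
        r≤j′ = ℕₚ.≤-pred (α≡β⇒index≤ r+1<k αᵣ₊₁≡βⱼ′₊₁)

      α↓-occurrence : Occurrence k1 L τ α↓
      α↓-occurrence =
        chain (λ r _ r+1<k →
                 shift-< r+1<k (α↓-shift (ℕₚ.<-trans (ℕₚ.n<1+n r) r+1<k)) (α↓-shift r+1<k) ,
                 subst₂ F._<_ (sym (τ-α↓ r+1<k)) (sym (τ-α↓ (ℕₚ.<-trans (ℕₚ.n<1+n r) r+1<k)))
                        (proj₂ (α-inversion (ℕₚ.n<1+n r) r+1<k))) ,
        board-mono (proj₂ α-occurrence) (shift-≤ (α↓-shift (ℕₚ.n<1+n k1))) (Fₚ.≤-reflexive (τ-α↓ (s≤s z≤n)))
        where
        τ-α↓ : ∀ {r} → r ℕ.< k → τ (α↓ r) ≡ σ (α r)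
        τ-α↓ = τ-shift ∘ α↓-shift

      τ-α↓₀ : τ (α↓ 0) ≡ m
      τ-α↓₀ = τ-shift (α↓-shift (s≤s z≤n))

proposition39 : (k : ℕ) → (2≤k : 2 Data.Nat.≤ k) → (n : ℕ) → (L : Board n) → IsFerrers L
    → (π : Permutation′ n) → IsFullRook L π
    → Contains k L (π ⟨$⟩ʳ_)
    → (a b : Fin k → Fin n) → IsASeq k L (π ⟨$⟩ʳ_) a → IsBSeq k L (π ⟨$⟩ʳ_) b
    → ¬ (∀ t → a t ≡ b t)
    → Contains k L (ψ k (π ⟨$⟩ʳ_) b)
      × ∃ (λ a′ → IsASeq k L (ψ k (π ⟨$⟩ʳ_) b) a′
          × ψ k (π ⟨$⟩ʳ_) b (a′ (fromℕ< (≤-trans (s≤s z≤n) 2≤k)))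
            ≡ (π ⟨$⟩ʳ a (fromℕ< (≤-trans (s≤s z≤n) 2≤k))))
proposition39 .(suc (suc k2)) (s≤s (s≤s {n = k2} z≤n)) n L ferrers π _ _ a b isA isB a≢b =
  τ-contains , a′ , isA′ , Fₚ.≤-antisym a′-head≤m m≤a′-head
  where
  σ-injective : ∀ {x y} → π ⟨$⟩ʳ x ≡ π ⟨$⟩ʳ y → x ≡ y
  σ-injective {x} {y} σx≡σy = trans (sym (inverseˡ π)) (trans (cong (π ⟨$⟩ˡ_) σx≡σy) (inverseˡ π))
  open BSequence L ferrers (suc k2) (π ⟨$⟩ʳ_) σ-injective b isB
  open ASequence a isA
  α₀≢β₀ : α 0 ≢ β 0
  α₀≢β₀ α₀≡β₀ = a≢b λ t → trans (cong a (sym (idx-toℕ t)))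
                   (trans (SameFirstDot.α≡β-below α₀≡β₀ k ℕₚ.≤-refl (Fₚ.toℕ<n t)) (cong b (idx-toℕ t)))
  open Shifted α₀≢β₀
  τ-contains : Contains k L τ
  τ-contains = α↓ ∘ toℕ , occurrence⇒Occ L τ α↓-occurrence
  τ-A-sequence : ∃ (IsASeq k L τ)
  τ-A-sequence = A-sequence-exists k L τ τ-contains
  a′ : Fin k → Fin n
  a′ = proj₁ τ-A-sequence
  isA′ : IsASeq k L τ a′
  isA′ = proj₂ τ-A-sequence
  a′-head≤m : τ (a′ F.zero) F.≤ m
  a′-head≤m = ℕₚ.≮⇒≥ λ m<a′-head → proj₂ isA′ (α↓ ∘ toℕ) (proj₂ τ-contains)
                (F.zero , subst (F._< τ (a′ F.zero)) (sym τ-α↓₀) m<a′-head , λ _ ())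
  m≤a′-head : m F.≤ τ (a′ F.zero)
  m≤a′-head = τ-occurrence-head≥m (a′ ∘ idx) (Occ⇒occurrence L τ a′ (proj₁ isA′))
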